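{- Let $A_1,\dots,A_m$ be a weak $(n,m)$-AMD code in a finite abelian group $G$ of order $n$, with $|A_i|=k_i$. Then the code is R-optimal if and only if $\{A_1,\dots,A_m\}$ is an $(n,m;k_1,\dots,k_m;\ell)$-RWEDF for some $\ell$.
   Context: $G$ is a finite abelian group of order $n$, written additively, and $G^*=G\setminus\{0\}$. A weak $(n,m)$-AMD code is a collection of pairwise disjoint nonempty subsets $A_1,\dots,A_m$ of $G$; write $k_i=|A_i|$ and $T=\sum_i k_i$. For $\delta\in G^*$ let $N_i(\delta)=|\{(a_i,a_j): a_i\in A_i,\ a_j\in A_j \text{ for some } j\neq i,\ a_i-a_j=\delta\}|$ and $e_\delta=\frac1m\sum_{i=1}^m \frac{1}{k_i}N_i(\delta)$. The code is R-optimal if $\max_{\delta\in G^*} e_\delta=\frac{(m-1)T}{m(n-1)}$. An $(n,m;k_1,\dots,k_m;\ell)$-RWEDF (reciprocally weighted external difference family) is a collection of pairwise disjoint subsets $A_1,\dots,A_m$ of $G$ with $|A_i|=k_i$ such that $\sum_{i=1}^m \frac{1}{k_i}N_i(\delta)=\ell$ for every $\delta\in G^*$ ($\ell$ a rational number). -}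

module Defs where

open import Level using (0ℓ)
open import Data.Bool using (Bool; true; false; if_then_else_)
open import Data.Nat using (ℕ; zero; suc; _∸_) renaming (_+_ to _+ℕ_; _*_ to _*ℕ_)
open import Data.Integer using (+_)
open import Data.Fin using (Fin; zero; suc)
open import Data.Fin.Properties using (any?) renaming (_≟_ to _≟ᶠ_)
open import Data.Fin.Subset using (Subset; _∈_; _∩_; Empty; Nonempty; ∣_∣)
open import Data.Fin.Subset.Properties using (_∈?_)
open import Data.Product using (Σ; ∃; _×_; _,_)
open import Data.Rational using (ℚ; 0ℚ; _/_; _≤_) renaming (_+_ to _+ℚ_; _*_ to _*ℚ_)
open import Relation.Nullary using (¬_; ¬?; Dec; yes; no; ⌊_⌋; _×-dec_)
open import Relation.Binary.PropositionalEquality using (_≡_; _≢_)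
open import Algebra.Structures using (IsAbelianGroup)

-- A finite abelian group of order n, represented on the carrier Fin n
-- (every finite abelian group of order n is isomorphic to such a structure).
record FinAbGroup (n : ℕ) : Set where
  field
    _⊕_ : Fin n → Fin n → Fin n
    𝟘 : Fin n
    ⊖_ : Fin n → Fin n
    isAbelianGroup : IsAbelianGroup _≡_ _⊕_ 𝟘 ⊖_

  _⊝_ : Fin n → Fin n → Fin n
  a ⊝ b = a ⊕ (⊖ b)

count : ∀ {n} → (Fin n → Bool) → ℕ
count {zero} p = 0
count {suc n} p = (if p zero then 1 else 0) +ℕ count (λ x → p (suc x))

sumℕ : ∀ {m} → (Fin m → ℕ) → ℕ
sumℕ {zero} f = 0
sumℕ {suc _} f = f zero +ℕ sumℕ (λ i → f (suc i))

∑ : ∀ {m} → (Fin m → ℚ) → ℚ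
∑ {zero} f = 0ℚ
∑ {suc m} f = f zero +ℚ ∑ (λ i → f (suc i))

-- the rational a / b (b ≠ 0 in every use below, guaranteed by the hypotheses;
-- the value at b = 0 is an irrelevant default)
frac : ℕ → ℕ → ℚ
frac a zero = 0ℚ
frac a (suc b) = (+ a) / suc b

IsWeakAMD : ∀ {n m} → (Fin m → Subset n) → Set
IsWeakAMD {n} {m} A =
  (∀ i j → i ≢ j → Empty (A i ∩ A j)) × (∀ i → Nonempty (A i))

module _ {n m : ℕ} (G : FinAbGroup n) (A : Fin m → Subset n) where
  open FinAbGroup G

  k : Fin m → ℕ
  k i = ∣ A i ∣

  T : ℕ
  T = sumℕ (λ i → k i)

  N : Fin m → Fin n → ℕ
  N i δ = sumℕ (λ a → count (λ b →
            ⌊ (a ∈? A i) ×-dec (any? (λ j → ¬? (j ≟ᶠ i) ×-dec (b ∈? A j)))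
                         ×-dec ((a ⊝ b) ≟ᶠ δ) ⌋))

  weightedSum : Fin n → ℚ
  weightedSum δ = ∑ (λ i → frac (N i δ) (k i))

  e : Fin n → ℚ
  e δ = frac 1 m *ℚ weightedSum δ

  bound : ℚ
  bound = frac ((m ∸ 1) *ℕ T) (m *ℕ (n ∸ 1))

  IsROptimal : Set
  IsROptimal = (∀ δ → δ ≢ 𝟘 → e δ ≤ bound) × (∃ λ δ → δ ≢ 𝟘 × e δ ≡ bound)

  -- (n,m;k_1..k_m;ℓ)-RWEDF (disjointness and |A_i| = k_i hold by construction/hypothesis)
  IsRWEDF : ℚ → Set
  IsRWEDF ℓ = ∀ δ → δ ≢ 𝟘 → weightedSum δ ≡ ℓ

module Submission where

-- Write W(δ) = ∑ᵢ Nᵢ(δ)/kᵢ, so that e_δ = W(δ)/m.  Two counting facts hold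
-- for every weak AMD code:
--   * W(0) = 0, because the blocks are disjoint, so no difference a − b
--     with a, b in different blocks vanishes;
--   * ∑_δ W(δ) = (m−1)T, because ∑_δ Nᵢ(δ) counts all pairs (a, b) with
--     a ∈ Aᵢ and b in another block, i.e. kᵢ(T − kᵢ).
-- Hence the n − 1 values W(δ), δ ≠ 0, have average c = (m−1)T/(n−1), and
-- the bound of R-optimality is c/m.  An averaging principle finishes the
-- proof: if all values are at most their average they all equal it, and
-- if they are all equal to some ℓ then ℓ = c.

open import Defs
open import Level using (0ℓ)
open import Algebra.Bundles using (Group; CommutativeRing)
open import Algebra.Structures using (IsAbelianGroup)
import Algebra.Properties.Group as GroupProperties
import Algebra.Properties.Semiring.Sum as SemiringSum
open import Data.Bool using (Bool; true; false; if_then_else_)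
open import Data.Fin using (Fin; zero; suc; punchIn; punchOut)
open import Data.Fin.Properties using (any?; punchInᵢ≢i; punchIn-punchOut)
  renaming (_≟_ to _≟ᶠ_)
open import Data.Fin.Subset using (Subset; _∈_; _∩_; Empty; Nonempty; ∣_∣; inside; outside)
open import Data.Fin.Subset.Properties using (_∈?_; x∈p∩q⁺; ∣⁅x⁆∣≡1; x∈⁅y⁆⇒x≡y; p⊆q⇒∣p∣≤∣q∣)
import Data.Integer as ℤ
import Data.Integer.Properties as ℤP
open import Data.Nat as ℕ using (ℕ; zero; suc; _+_; _*_; _∸_; _≤_; s≤s; NonZero)
import Data.Nat.Properties as ℕP
open import Data.Product using (∃; _×_; _,_)
open import Data.Rational using (ℚ; 0ℚ; 1ℚ; toℚᵘ; -_; Positive)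
  renaming (_+_ to _+ℚ_; _*_ to _*ℚ_; _≤_ to _≤ℚ_)
import Data.Rational.Properties as ℚP
open import Data.Rational.Solver using (module +-*-Solver)
import Data.Rational.Unnormalised as ℚᵘ
import Data.Rational.Unnormalised.Properties as ℚᵘP
open import Data.Vec using ([]; _∷_)
open import Data.Vec.Functional using (removeAt)
open import Function.Base using (_∘_)
open import Function.Bundles using (_⇔_; mk⇔)
open import Relation.Binary.PropositionalEquality
open import Relation.Nullary using (¬_; ¬?; Dec; yes; no; ⌊_⌋; _×-dec_)
open import Relation.Nullary.Decidable using (isYes≗does; dec-true; dec-false; decidable-stable)

open ≡-Reasoning

module ℕΣ = SemiringSum ℕP.+-*-semiring
module ℚΣ = SemiringSum (CommutativeRing.semiring ℚP.+-*-commutativeRing)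

sumℕ≡sum : ∀ {n} (f : Fin n → ℕ) → sumℕ f ≡ ℕΣ.sum f
sumℕ≡sum {zero} f = refl
sumℕ≡sum {suc n} f = cong (f zero +_) (sumℕ≡sum (f ∘ suc))

∑≡sum : ∀ {n} (f : Fin n → ℚ) → ∑ f ≡ ℚΣ.sum f
∑≡sum {zero} f = refl
∑≡sum {suc n} f = cong (f zero +ℚ_) (∑≡sum (f ∘ suc))

ℕ-sum-zeros : ∀ {n} {f : Fin n → ℕ} → (∀ i → f i ≡ 0) → ℕΣ.sum f ≡ 0
ℕ-sum-zeros {n} f≡0 = trans (ℕΣ.sum-cong-≗ f≡0) (ℕΣ.sum-replicate-zero n)

ℚ-sum-zeros : ∀ {n} {f : Fin n → ℚ} → (∀ i → f i ≡ 0ℚ) → ℚΣ.sum f ≡ 0ℚ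
ℚ-sum-zeros {n} f≡0 = trans (ℚΣ.sum-cong-≗ f≡0) (ℚΣ.sum-replicate-zero n)

sum-single : ∀ {n} (f : Fin n → ℕ) j → (∀ i → i ≢ j → f i ≡ 0) → ℕΣ.sum f ≡ f j
sum-single {suc n} f j f≡0 = begin
  ℕΣ.sum f                       ≡⟨ ℕΣ.sum-remove {i = j} f ⟩
  f j + ℕΣ.sum (removeAt f j)    ≡⟨ cong (f j +_) (ℕ-sum-zeros (λ i → f≡0 _ (punchInᵢ≢i j i))) ⟩
  f j + 0                        ≡⟨ ℕP.+-identityʳ (f j) ⟩
  f j                            ∎

ℕ-sum-const : ∀ n x → ℕΣ.sum {n} (λ _ → x) ≡ n * x
ℕ-sum-const zero x = refl
ℕ-sum-const (suc n) x = cong (x +_) (ℕ-sum-const n x)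

ℚ-sum-mono : ∀ {n} (f g : Fin n → ℚ) → (∀ i → f i ≤ℚ g i) → ℚΣ.sum f ≤ℚ ℚΣ.sum g
ℚ-sum-mono {zero} f g f≤g = ℚP.≤-refl
ℚ-sum-mono {suc n} f g f≤g = ℚP.+-mono-≤ (f≤g zero) (ℚ-sum-mono (f ∘ suc) (g ∘ suc) (f≤g ∘ suc))

sum-≤-≡ : ∀ {n} (f g : Fin n → ℚ) → (∀ i → f i ≤ℚ g i) → ℚΣ.sum f ≡ ℚΣ.sum g → ∀ i → f i ≡ g i
sum-≤-≡ {suc n} f g f≤g sums≡ = termwise
  where
  open GroupProperties ℚP.+-0-group using (∙-cancelˡ; //-rightDividesʳ)
  Sf Sg : ℚ
  Sf = ℚΣ.sum (f ∘ suc)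
  Sg = ℚΣ.sum (g ∘ suc)
  -- g₀ + Sg = f₀ + Sf ≤ f₀ + Sg, and subtracting Sg gives g₀ ≤ f₀.
  g₀≤f₀ : g zero ≤ℚ f zero
  g₀≤f₀ = subst₂ _≤ℚ_ (//-rightDividesʳ Sg (g zero)) (//-rightDividesʳ Sg (f zero))
    (ℚP.+-monoˡ-≤ (- Sg) (subst (_≤ℚ f zero +ℚ Sg) sums≡
      (ℚP.+-monoʳ-≤ (f zero) (ℚ-sum-mono (f ∘ suc) (g ∘ suc) (f≤g ∘ suc)))))
  head≡ : f zero ≡ g zero
  head≡ = ℚP.≤-antisym (f≤g zero) g₀≤f₀
  tail≡ : Sf ≡ Sg
  tail≡ = ∙-cancelˡ (f zero) Sf Sg (trans sums≡ (cong (_+ℚ Sg) (sym head≡)))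
  termwise : ∀ i → f i ≡ g i
  termwise zero = head≡
  termwise (suc i) = sum-≤-≡ (f ∘ suc) (g ∘ suc) (f≤g ∘ suc) tail≡ i

ι : ℕ → ℚ
ι a = frac a 1

toℚᵘ-frac : ∀ a b → toℚᵘ (frac a (suc b)) ℚᵘ.≃ ℚᵘ.mkℚᵘ (ℤ.+ a) b
toℚᵘ-frac a b = ℚP.toℚᵘ-fromℚᵘ (ℚᵘ.mkℚᵘ (ℤ.+ a) b)

via-ℚᵘ : ∀ {p q x y} → toℚᵘ p ℚᵘ.≃ x → toℚᵘ q ℚᵘ.≃ y → x ℚᵘ.≃ y → p ≡ q
via-ℚᵘ p≃x q≃y x≃y = ℚP.toℚᵘ-injective (ℚᵘP.≃-trans p≃x (ℚᵘP.≃-trans x≃y (ℚᵘP.≃-sym q≃y)))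

ι-+ : ∀ a b → ι (a + b) ≡ ι a +ℚ ι b
ι-+ a b = via-ℚᵘ (toℚᵘ-frac (a + b) 0)
  (ℚᵘP.≃-trans (ℚP.toℚᵘ-homo-+ (ι a) (ι b)) (ℚᵘP.+-cong (toℚᵘ-frac a 0) (toℚᵘ-frac b 0)))
  (ℚᵘ.*≡* (trans (ℤP.*-identityʳ _) (trans (ℤP.pos-+ a b) (sym (trans (ℤP.*-identityʳ _)
    (cong₂ ℤ._+_ (ℤP.*-identityʳ (ℤ.+ a)) (ℤP.*-identityʳ (ℤ.+ b))))))))

ι-* : ∀ a b → ι (a * b) ≡ ι a *ℚ ι b
ι-* a b = via-ℚᵘ (toℚᵘ-frac (a * b) 0)
  (ℚᵘP.≃-trans (ℚP.toℚᵘ-homo-* (ι a) (ι b)) (ℚᵘP.*-cong (toℚᵘ-frac a 0) (toℚᵘ-frac b 0)))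
  (ℚᵘ.*≡* (cong (ℤ._* ℤ.+ 1) (ℤP.pos-* a b)))

ι-sum : ∀ {n} (f : Fin n → ℕ) → ℚΣ.sum (ι ∘ f) ≡ ι (ℕΣ.sum f)
ι-sum {zero} f = refl
ι-sum {suc n} f = trans (cong (ι (f zero) +ℚ_) (ι-sum (f ∘ suc))) (sym (ι-+ (f zero) _))

ℚ-sum-const : ∀ n c → ℚΣ.sum {n} (λ _ → c) ≡ ι n *ℚ c
ℚ-sum-const zero c = sym (ℚP.*-zeroˡ c)
ℚ-sum-const (suc n) c = begin
  c +ℚ ℚΣ.sum {n} (λ _ → c)   ≡⟨ cong (c +ℚ_) (ℚ-sum-const n c) ⟩
  c +ℚ ι n *ℚ c               ≡⟨ cong (_+ℚ ι n *ℚ c) (ℚP.*-identityˡ c) ⟨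
  1ℚ *ℚ c +ℚ ι n *ℚ c         ≡⟨ ℚP.*-distribʳ-+ c 1ℚ (ι n) ⟨
  (1ℚ +ℚ ι n) *ℚ c            ≡⟨ cong (_*ℚ c) (ι-+ 1 n) ⟨
  ι (suc n) *ℚ c              ∎

ι*frac : ∀ a d .{{_ : NonZero d}} → ι d *ℚ frac a d ≡ ι a
ι*frac a (suc b) = trans (ℚP.*-comm (ι (suc b)) (frac a (suc b))) (via-ℚᵘ
  (ℚᵘP.≃-trans (ℚP.toℚᵘ-homo-* (frac a (suc b)) (ι (suc b))) (ℚᵘP.*-cong (toℚᵘ-frac a b) (toℚᵘ-frac (suc b) 0)))
  (toℚᵘ-frac a 0)
  (ℚᵘ.*≡* (trans (ℤP.*-identityʳ _) (cong (λ x → ℤ.+ a ℤ.* ℤ.+ suc x) (sym (ℕP.*-identityʳ b))))))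

ι*-cancel : ∀ d .{{_ : NonZero d}} {p q} → ι d *ℚ p ≡ ι d *ℚ q → p ≡ q
ι*-cancel d {p} {q} dp≡dq = begin
  p                         ≡⟨ undo p ⟨
  frac 1 d *ℚ (ι d *ℚ p)    ≡⟨ cong (frac 1 d *ℚ_) dp≡dq ⟩
  frac 1 d *ℚ (ι d *ℚ q)    ≡⟨ undo q ⟩
  q                         ∎
  where
  undo : ∀ r → frac 1 d *ℚ (ι d *ℚ r) ≡ r
  undo r = begin
    frac 1 d *ℚ (ι d *ℚ r)   ≡⟨ ℚP.*-assoc (frac 1 d) (ι d) r ⟨
    frac 1 d *ℚ ι d *ℚ r     ≡⟨ cong (_*ℚ r) (trans (ℚP.*-comm (frac 1 d) (ι d)) (ι*frac 1 d)) ⟩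
    1ℚ *ℚ r                  ≡⟨ ℚP.*-identityˡ r ⟩
    r                        ∎

frac-unique : ∀ a d .{{_ : NonZero d}} {q} → ι d *ℚ q ≡ ι a → q ≡ frac a d
frac-unique a d dq≡a = ι*-cancel d (trans dq≡a (sym (ι*frac a d)))

frac-cancel : ∀ d a .{{_ : NonZero d}} → frac (d * a) d ≡ ι a
frac-cancel d a = sym (frac-unique (d * a) d (sym (ι-* d a)))

frac-zero : ∀ d → frac 0 d ≡ 0ℚ
frac-zero zero = refl
frac-zero (suc d) = ℚP.0/n≡0 (suc d)

frac-prod : ∀ a m d .{{_ : NonZero m}} .{{_ : NonZero d}} →
  frac a (m * d) ≡ frac 1 m *ℚ frac a d
frac-prod a m d = sym (frac-unique a (m * d) {{ℕP.m*n≢0 m d}} (begin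
  ι (m * d) *ℚ (frac 1 m *ℚ frac a d)        ≡⟨ cong (_*ℚ (frac 1 m *ℚ frac a d)) (ι-* m d) ⟩
  ι m *ℚ ι d *ℚ (frac 1 m *ℚ frac a d)       ≡⟨ regroup (ι m) (ι d) (frac 1 m) (frac a d) ⟩
  (ι m *ℚ frac 1 m) *ℚ (ι d *ℚ frac a d)     ≡⟨ cong₂ _*ℚ_ (ι*frac 1 m) (ι*frac a d) ⟩
  1ℚ *ℚ ι a                                  ≡⟨ ℚP.*-identityˡ (ι a) ⟩
  ι a                                        ∎))
  where
  open +-*-Solver
  regroup : ∀ w x y z → w *ℚ x *ℚ (y *ℚ z) ≡ (w *ℚ y) *ℚ (x *ℚ z)
  regroup = solve 4 (λ w x y z → w :* x :* (y :* z) := (w :* y) :* (x :* z)) refl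

sum-frac : ∀ {n} d .{{_ : NonZero d}} (f : Fin n → ℕ) →
  ℚΣ.sum (λ i → frac (f i) d) ≡ frac (ℕΣ.sum f) d
sum-frac d f = frac-unique (ℕΣ.sum f) d (begin
  ι d *ℚ ℚΣ.sum (λ i → frac (f i) d)   ≡⟨ ℚΣ.*-distribˡ-sum (ι d) (λ i → frac (f i) d) ⟩
  ℚΣ.sum (λ i → ι d *ℚ frac (f i) d)   ≡⟨ ℚΣ.sum-cong-≗ (λ i → ι*frac (f i) d) ⟩
  ℚΣ.sum (ι ∘ f)                       ≡⟨ ι-sum f ⟩
  ι (ℕΣ.sum f)                         ∎)

module Averaging {p : ℕ} (W : Fin (suc p) → ℚ) (z : Fin (suc p))
                 (W-z : W z ≡ 0ℚ) {c : ℚ} (total : ℚΣ.sum W ≡ ι p *ℚ c) where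

  W′ : Fin p → ℚ
  W′ = removeAt W z

  sum-W′ : ℚΣ.sum W′ ≡ ι p *ℚ c
  sum-W′ = begin
    ℚΣ.sum W′           ≡⟨ ℚP.+-identityˡ (ℚΣ.sum W′) ⟨
    0ℚ +ℚ ℚΣ.sum W′     ≡⟨ cong (_+ℚ ℚΣ.sum W′) W-z ⟨
    W z +ℚ ℚΣ.sum W′    ≡⟨ ℚΣ.sum-remove {i = z} W ⟨
    ℚΣ.sum W            ≡⟨ total ⟩
    ι p *ℚ c            ∎

  W≡W′ : ∀ {δ} (δ≢z : δ ≢ z) → W δ ≡ W′ (punchOut (δ≢z ∘ sym))
  W≡W′ δ≢z = cong W (sym (punchIn-punchOut (δ≢z ∘ sym)))

  bounded⇒average : (∀ δ → δ ≢ z → W δ ≤ℚ c) → ∀ δ → δ ≢ z → W δ ≡ c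
  bounded⇒average W≤c δ δ≢z = trans (W≡W′ δ≢z) (sum-≤-≡ W′ (λ _ → c)
    (λ i → W≤c (punchIn z i) (punchInᵢ≢i z i))
    (trans sum-W′ (sym (ℚ-sum-const p c))) _)

  constant⇒average : .{{_ : NonZero p}} → ∀ ℓ → (∀ δ → δ ≢ z → W δ ≡ ℓ) → ℓ ≡ c
  constant⇒average ℓ W≡ℓ = ι*-cancel p (begin
    ι p *ℚ ℓ                ≡⟨ ℚ-sum-const p ℓ ⟨
    ℚΣ.sum {p} (λ _ → ℓ)    ≡⟨ ℚΣ.sum-cong-≗ (λ i → W≡ℓ (punchIn z i) (punchInᵢ≢i z i)) ⟨
    ℚΣ.sum W′               ≡⟨ sum-W′ ⟩
    ι p *ℚ c                ∎)

ind : Bool → ℕ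
ind b = if b then 1 else 0

count≡sum : ∀ {n} (p : Fin n → Bool) → count p ≡ ℕΣ.sum (ind ∘ p)
count≡sum {zero} p = refl
count≡sum {suc n} p = cong (ind (p zero) +_) (count≡sum (p ∘ suc))

isYes-true : ∀ {P : Set} (P? : Dec P) → P → ⌊ P? ⌋ ≡ true
isYes-true P? p = trans (isYes≗does P?) (dec-true P? p)

isYes-false : ∀ {P : Set} (P? : Dec P) → ¬ P → ⌊ P? ⌋ ≡ false
isYes-false P? ¬p = trans (isYes≗does P?) (dec-false P? ¬p)

ind-× : ∀ {P Q : Set} (P? : Dec P) (Q? : Dec Q) → ind ⌊ P? ×-dec Q? ⌋ ≡ ind ⌊ P? ⌋ * ind ⌊ Q? ⌋
ind-× (yes _) (yes _) = refl
ind-× (yes _) (no _) = refl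
ind-× (no _) _ = refl

ind-split : ∀ {P Q : Set} (P? : Dec P) (Q? : Dec Q) → ind ⌊ ¬? P? ×-dec Q? ⌋ + ind ⌊ P? ×-dec Q? ⌋ ≡ ind ⌊ Q? ⌋
ind-split (yes _) (yes _) = refl
ind-split (yes _) (no _) = refl
ind-split (no _) (yes _) = refl
ind-split (no _) (no _) = refl

delta-sum : ∀ {q} (x : Fin q) → ℕΣ.sum (λ δ → ind ⌊ x ≟ᶠ δ ⌋) ≡ 1
delta-sum x = trans (sum-single _ x (λ δ δ≢x → cong ind (isYes-false (x ≟ᶠ δ) (δ≢x ∘ sym))))
                    (cong ind (isYes-true (x ≟ᶠ x) refl))

ind-any-unique : ∀ {m} {Q : Fin m → Set} (Q? : ∀ j → Dec (Q j)) → (∀ j j′ → Q j → Q j′ → j ≡ j′) →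
  ind ⌊ any? Q? ⌋ ≡ ℕΣ.sum (λ j → ind ⌊ Q? j ⌋)
ind-any-unique Q? unique with any? Q?
... | yes (j , qj) = sym (trans
        (sum-single _ j (λ i i≢j → cong ind (isYes-false (Q? i) (λ qi → i≢j (unique i j qi qj)))))
        (cong ind (isYes-true (Q? j) qj)))
... | no ¬∃ = sym (ℕ-sum-zeros (λ j → cong ind (isYes-false (Q? j) (λ qj → ¬∃ (j , qj)))))

sum-split-at : ∀ {m} {X : Fin m → Set} (X? : ∀ j → Dec (X j)) i →
  ℕΣ.sum (λ j → ind ⌊ ¬? (j ≟ᶠ i) ×-dec X? j ⌋) + ind ⌊ X? i ⌋ ≡ ℕΣ.sum (λ j → ind ⌊ X? j ⌋)
sum-split-at X? i = begin
  ℕΣ.sum (λ j → ind ⌊ ¬? (j ≟ᶠ i) ×-dec X? j ⌋) + ind ⌊ X? i ⌋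
    ≡⟨ cong (ℕΣ.sum (λ j → ind ⌊ ¬? (j ≟ᶠ i) ×-dec X? j ⌋) +_) at-i ⟨
  ℕΣ.sum (λ j → ind ⌊ ¬? (j ≟ᶠ i) ×-dec X? j ⌋) + ℕΣ.sum (λ j → ind ⌊ (j ≟ᶠ i) ×-dec X? j ⌋)
    ≡⟨ ℕΣ.∑-distrib-+ (λ j → ind ⌊ ¬? (j ≟ᶠ i) ×-dec X? j ⌋) (λ j → ind ⌊ (j ≟ᶠ i) ×-dec X? j ⌋) ⟨
  ℕΣ.sum (λ j → ind ⌊ ¬? (j ≟ᶠ i) ×-dec X? j ⌋ + ind ⌊ (j ≟ᶠ i) ×-dec X? j ⌋)
    ≡⟨ ℕΣ.sum-cong-≗ (λ j → ind-split (j ≟ᶠ i) (X? j)) ⟩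
  ℕΣ.sum (λ j → ind ⌊ X? j ⌋) ∎
  where
  at-i : ℕΣ.sum (λ j → ind ⌊ (j ≟ᶠ i) ×-dec X? j ⌋) ≡ ind ⌊ X? i ⌋
  at-i = begin
    ℕΣ.sum (λ j → ind ⌊ (j ≟ᶠ i) ×-dec X? j ⌋)
      ≡⟨ sum-single _ i (λ j j≢i → cong ind (isYes-false ((j ≟ᶠ i) ×-dec X? j) (λ (j≡i , _) → j≢i j≡i))) ⟩
    ind ⌊ (i ≟ᶠ i) ×-dec X? i ⌋
      ≡⟨ ind-× (i ≟ᶠ i) (X? i) ⟩
    ind ⌊ i ≟ᶠ i ⌋ * ind ⌊ X? i ⌋
      ≡⟨ cong (λ b → ind b * ind ⌊ X? i ⌋) (isYes-true (i ≟ᶠ i) refl) ⟩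
    1 * ind ⌊ X? i ⌋
      ≡⟨ ℕP.*-identityˡ _ ⟩
    ind ⌊ X? i ⌋ ∎

fibres : ∀ {r s q} {P : Fin r → Set} {Q : Fin s → Set}
  (P? : ∀ a → Dec (P a)) (Q? : ∀ b → Dec (Q b)) (d : Fin r → Fin s → Fin q) →
  ℕΣ.sum (λ δ → ℕΣ.sum (λ a → ℕΣ.sum (λ b → ind ⌊ P? a ×-dec Q? b ×-dec (d a b ≟ᶠ δ) ⌋)))
    ≡ ℕΣ.sum (λ a → ind ⌊ P? a ⌋) * ℕΣ.sum (λ b → ind ⌊ Q? b ⌋)
fibres {r} {s} {q} P? Q? d = begin
  ℕΣ.sum (λ δ → ℕΣ.sum (λ a → ℕΣ.sum (λ b → F a b δ)))
    ≡⟨ ℕΣ.∑-comm (λ δ a → ℕΣ.sum (λ b → F a b δ)) ⟩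
  ℕΣ.sum (λ a → ℕΣ.sum (λ δ → ℕΣ.sum (λ b → F a b δ)))
    ≡⟨ ℕΣ.sum-cong-≗ (λ a → ℕΣ.∑-comm (λ δ b → F a b δ)) ⟩
  ℕΣ.sum (λ a → ℕΣ.sum (λ b → ℕΣ.sum (λ δ → F a b δ)))
    ≡⟨ ℕΣ.sum-cong-≗ (λ a → ℕΣ.sum-cong-≗ (λ b → one-value a b)) ⟩
  ℕΣ.sum (λ a → ℕΣ.sum (λ b → ind ⌊ P? a ⌋ * ind ⌊ Q? b ⌋))
    ≡⟨ ℕΣ.sum-cong-≗ (λ a → ℕΣ.*-distribˡ-sum (ind ⌊ P? a ⌋) (λ b → ind ⌊ Q? b ⌋)) ⟨
  ℕΣ.sum (λ a → ind ⌊ P? a ⌋ * ℕΣ.sum (λ b → ind ⌊ Q? b ⌋))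
    ≡⟨ ℕΣ.*-distribʳ-sum (ℕΣ.sum (λ b → ind ⌊ Q? b ⌋)) (λ a → ind ⌊ P? a ⌋) ⟨
  ℕΣ.sum (λ a → ind ⌊ P? a ⌋) * ℕΣ.sum (λ b → ind ⌊ Q? b ⌋) ∎
  where
  F : Fin r → Fin s → Fin q → ℕ
  F a b δ = ind ⌊ P? a ×-dec Q? b ×-dec (d a b ≟ᶠ δ) ⌋
  one-value : ∀ a b → ℕΣ.sum (λ δ → F a b δ) ≡ ind ⌊ P? a ⌋ * ind ⌊ Q? b ⌋
  one-value a b = begin
    ℕΣ.sum (λ δ → F a b δ)
      ≡⟨ ℕΣ.sum-cong-≗ (λ δ → factor δ) ⟩
    ℕΣ.sum (λ δ → (ind ⌊ P? a ⌋ * ind ⌊ Q? b ⌋) * ind ⌊ d a b ≟ᶠ δ ⌋)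
      ≡⟨ ℕΣ.*-distribˡ-sum (ind ⌊ P? a ⌋ * ind ⌊ Q? b ⌋) (λ δ → ind ⌊ d a b ≟ᶠ δ ⌋) ⟨
    (ind ⌊ P? a ⌋ * ind ⌊ Q? b ⌋) * ℕΣ.sum (λ δ → ind ⌊ d a b ≟ᶠ δ ⌋)
      ≡⟨ cong ((ind ⌊ P? a ⌋ * ind ⌊ Q? b ⌋) *_) (delta-sum (d a b)) ⟩
    (ind ⌊ P? a ⌋ * ind ⌊ Q? b ⌋) * 1
      ≡⟨ ℕP.*-identityʳ _ ⟩
    ind ⌊ P? a ⌋ * ind ⌊ Q? b ⌋ ∎
    where
    factor : ∀ δ → F a b δ ≡ (ind ⌊ P? a ⌋ * ind ⌊ Q? b ⌋) * ind ⌊ d a b ≟ᶠ δ ⌋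
    factor δ = begin
      F a b δ
        ≡⟨ ind-× (P? a) (Q? b ×-dec (d a b ≟ᶠ δ)) ⟩
      ind ⌊ P? a ⌋ * ind ⌊ Q? b ×-dec (d a b ≟ᶠ δ) ⌋
        ≡⟨ cong (ind ⌊ P? a ⌋ *_) (ind-× (Q? b) (d a b ≟ᶠ δ)) ⟩
      ind ⌊ P? a ⌋ * (ind ⌊ Q? b ⌋ * ind ⌊ d a b ≟ᶠ δ ⌋)
        ≡⟨ ℕP.*-assoc (ind ⌊ P? a ⌋) (ind ⌊ Q? b ⌋) _ ⟨
      (ind ⌊ P? a ⌋ * ind ⌊ Q? b ⌋) * ind ⌊ d a b ≟ᶠ δ ⌋ ∎

∈?-suc : ∀ {n} (x : Fin n) s (p : Subset n) → ⌊ suc x ∈? (s ∷ p) ⌋ ≡ ⌊ x ∈? p ⌋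
∈?-suc x s p = trans (isYes≗does (suc x ∈? (s ∷ p))) (sym (isYes≗does (x ∈? p)))

size≡sum : ∀ {n} (p : Subset n) → ∣ p ∣ ≡ ℕΣ.sum (λ x → ind ⌊ x ∈? p ⌋)
size≡sum [] = refl
size≡sum (inside ∷ p) =
  cong suc (trans (size≡sum p) (ℕΣ.sum-cong-≗ (λ x → cong ind (sym (∈?-suc x inside p)))))
size≡sum (outside ∷ p) =
  trans (size≡sum p) (ℕΣ.sum-cong-≗ (λ x → cong ind (sym (∈?-suc x outside p))))

nonempty⇒nonZero : ∀ {n} {p : Subset n} → Nonempty p → NonZero ∣ p ∣
nonempty⇒nonZero {p = p} (x , x∈p) = ℕ.>-nonZero (subst (_≤ ∣ p ∣) (∣⁅x⁆∣≡1 x)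
  (p⊆q⇒∣p∣≤∣q∣ (λ y∈⁅x⁆ → subst (_∈ p) (sym (x∈⁅y⁆⇒x≡y x y∈⁅x⁆)) x∈p)))

module DisjointBlocks {n m : ℕ} (G : FinAbGroup n) (A : Fin m → Subset n)
                      (disjoint : ∀ i j → i ≢ j → Empty (A i ∩ A j)) where
  open FinAbGroup G

  group : Group 0ℓ 0ℓ
  group = record { isGroup = IsAbelianGroup.isGroup isAbelianGroup }

  ⊝≡𝟘⇒≡ : ∀ a b → a ⊝ b ≡ 𝟘 → a ≡ b
  ⊝≡𝟘⇒≡ = GroupProperties.x∙y⁻¹≈ε⇒x≈y group

  same-block : ∀ b j j′ → b ∈ A j → b ∈ A j′ → j ≡ j′
  same-block b j j′ b∈Aj b∈Aj′ =
    decidable-stable (j ≟ᶠ j′) (λ j≢j′ → disjoint j j′ j≢j′ (b , x∈p∩q⁺ (b∈Aj , b∈Aj′)))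

  inOther? : ∀ i b → Dec (∃ λ j → j ≢ i × b ∈ A j)
  inOther? i b = any? (λ j → ¬? (j ≟ᶠ i) ×-dec (b ∈? A j))

  others : Fin m → ℕ
  others i = ℕΣ.sum (λ b → ind ⌊ inOther? i b ⌋)

  pair? : ∀ i δ a b → Dec (a ∈ A i × (∃ λ j → j ≢ i × b ∈ A j) × a ⊝ b ≡ δ)
  pair? i δ a b = (a ∈? A i) ×-dec inOther? i b ×-dec ((a ⊝ b) ≟ᶠ δ)

  N≡sum : ∀ i δ → N G A i δ ≡ ℕΣ.sum (λ a → ℕΣ.sum (λ b → ind ⌊ pair? i δ a b ⌋))
  N≡sum i δ = trans (sumℕ≡sum (λ a → count (λ b → ⌊ pair? i δ a b ⌋))) (ℕΣ.sum-cong-≗ (λ a → count≡sum (λ b → ⌊ pair? i δ a b ⌋)))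

  -- Nᵢ(0) = 0: a − b = 0 would put a = b in two distinct blocks.
  N-zero : ∀ i → N G A i 𝟘 ≡ 0
  N-zero i = trans (N≡sum i 𝟘) (ℕ-sum-zeros (λ a → ℕ-sum-zeros (λ b →
    cong ind (isYes-false (pair? i 𝟘 a b) (λ (a∈Ai , (j , j≢i , b∈Aj) , a⊝b≡𝟘) →
      j≢i (same-block b j i b∈Aj (subst (_∈ A i) (⊝≡𝟘⇒≡ a b a⊝b≡𝟘) a∈Ai)))))))

  weightedSum-zero : weightedSum G A 𝟘 ≡ 0ℚ
  weightedSum-zero = trans (∑≡sum (λ i → frac (N G A i 𝟘) (k G A i))) (ℚ-sum-zeros (λ i →
    trans (cong (λ x → frac x (k G A i)) (N-zero i)) (frac-zero (k G A i))))

  sum-N : ∀ i → ℕΣ.sum (N G A i) ≡ k G A i * others i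
  sum-N i = begin
    ℕΣ.sum (N G A i)
      ≡⟨ ℕΣ.sum-cong-≗ (N≡sum i) ⟩
    ℕΣ.sum (λ δ → ℕΣ.sum (λ a → ℕΣ.sum (λ b → ind ⌊ pair? i δ a b ⌋)))
      ≡⟨ fibres (_∈? A i) (inOther? i) _⊝_ ⟩
    ℕΣ.sum (λ a → ind ⌊ a ∈? A i ⌋) * others i
      ≡⟨ cong (_* others i) (size≡sum (A i)) ⟨
    k G A i * others i ∎

  others+k≡T : ∀ i → others i + k G A i ≡ T G A
  others+k≡T i = begin
    others i + k G A i
      ≡⟨ cong (others i +_) (size≡sum (A i)) ⟩
    others i + ℕΣ.sum (λ b → ind ⌊ b ∈? A i ⌋)
      ≡⟨ ℕΣ.∑-distrib-+ (λ b → ind ⌊ inOther? i b ⌋) (λ b → ind ⌊ b ∈? A i ⌋) ⟨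
    ℕΣ.sum (λ b → ind ⌊ inOther? i b ⌋ + ind ⌊ b ∈? A i ⌋)
      ≡⟨ ℕΣ.sum-cong-≗ blocks-through ⟩
    ℕΣ.sum (λ b → ℕΣ.sum (λ j → ind ⌊ b ∈? A j ⌋))
      ≡⟨ ℕΣ.∑-comm (λ b j → ind ⌊ b ∈? A j ⌋) ⟩
    ℕΣ.sum (λ j → ℕΣ.sum (λ b → ind ⌊ b ∈? A j ⌋))
      ≡⟨ ℕΣ.sum-cong-≗ (λ j → size≡sum (A j)) ⟨
    ℕΣ.sum (k G A)
      ≡⟨ sumℕ≡sum (k G A) ⟨
    T G A ∎
    where
    blocks-through : ∀ b → ind ⌊ inOther? i b ⌋ + ind ⌊ b ∈? A i ⌋ ≡ ℕΣ.sum (λ j → ind ⌊ b ∈? A j ⌋)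
    blocks-through b = trans
      (cong (_+ ind ⌊ b ∈? A i ⌋) (ind-any-unique _ (λ j j′ (_ , b∈Aj) (_ , b∈Aj′) → same-block b j j′ b∈Aj b∈Aj′)))
      (sum-split-at (λ j → b ∈? A j) i)

  sum-others : ℕΣ.sum others ≡ (m ∸ 1) * T G A
  sum-others = begin
    ℕΣ.sum others                    ≡⟨ ℕP.m+n∸n≡m (ℕΣ.sum others) (T G A) ⟨
    ℕΣ.sum others + T G A ∸ T G A    ≡⟨ cong (_∸ T G A) all-pairs ⟩
    m * T G A ∸ T G A                ≡⟨ cong (m * T G A ∸_) (ℕP.*-identityˡ (T G A)) ⟨
    m * T G A ∸ 1 * T G A            ≡⟨ ℕP.*-distribʳ-∸ (T G A) m 1 ⟨
    (m ∸ 1) * T G A                  ∎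
    where
    all-pairs : ℕΣ.sum others + T G A ≡ m * T G A
    all-pairs = begin
      ℕΣ.sum others + T G A                ≡⟨ cong (ℕΣ.sum others +_) (sumℕ≡sum (k G A)) ⟩
      ℕΣ.sum others + ℕΣ.sum (k G A)       ≡⟨ ℕΣ.∑-distrib-+ others (k G A) ⟨
      ℕΣ.sum (λ i → others i + k G A i)    ≡⟨ ℕΣ.sum-cong-≗ others+k≡T ⟩
      ℕΣ.sum {m} (λ _ → T G A)             ≡⟨ ℕ-sum-const m (T G A) ⟩
      m * T G A                            ∎

module WeakAMDCode {n m : ℕ} (G : FinAbGroup n) (A : Fin m → Subset n)
                   (disjoint : ∀ i j → i ≢ j → Empty (A i ∩ A j)) (nonempty : ∀ i → Nonempty (A i)) where
  open DisjointBlocks G A disjoint public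

  k-nonZero : ∀ i → NonZero (k G A i)
  k-nonZero i = nonempty⇒nonZero (nonempty i)

  total-weight : ℚΣ.sum (weightedSum G A) ≡ ι ((m ∸ 1) * T G A)
  total-weight = begin
    ℚΣ.sum (weightedSum G A)
      ≡⟨ ℚΣ.sum-cong-≗ (λ δ → ∑≡sum (λ i → frac (N G A i δ) (k G A i))) ⟩
    ℚΣ.sum (λ δ → ℚΣ.sum (λ i → frac (N G A i δ) (k G A i)))
      ≡⟨ ℚΣ.∑-comm (λ δ i → frac (N G A i δ) (k G A i)) ⟩
    ℚΣ.sum (λ i → ℚΣ.sum (λ δ → frac (N G A i δ) (k G A i)))
      ≡⟨ ℚΣ.sum-cong-≗ (λ i → sum-frac (k G A i) {{k-nonZero i}} (N G A i)) ⟩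
    ℚΣ.sum (λ i → frac (ℕΣ.sum (N G A i)) (k G A i))
      ≡⟨ ℚΣ.sum-cong-≗ (λ i → cong (λ x → frac x (k G A i)) (sum-N i)) ⟩
    ℚΣ.sum (λ i → frac (k G A i * others i) (k G A i))
      ≡⟨ ℚΣ.sum-cong-≗ (λ i → frac-cancel (k G A i) (others i) {{k-nonZero i}}) ⟩
    ℚΣ.sum (ι ∘ others)
      ≡⟨ ι-sum others ⟩
    ι (ℕΣ.sum others)
      ≡⟨ cong ι sum-others ⟩
    ι ((m ∸ 1) * T G A) ∎

mainTheorem2 : ∀ {n m : ℕ} → 2 ≤ n → 1 ≤ m →
    (G : FinAbGroup n) (A : Fin m → Subset n) → IsWeakAMD A →
    IsROptimal G A ⇔ (∃ λ ℓ → IsRWEDF G A ℓ)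
mainTheorem2 {suc zero} (s≤s ())
mainTheorem2 {suc (suc n′)} {suc m′} _ _ G A (disjoint , nonempty) = mk⇔ optimal⇒rwedf rwedf⇒optimal
  where
  open FinAbGroup G using (𝟘)
  open WeakAMDCode G A disjoint nonempty using (weightedSum-zero; total-weight)
  c : ℚ
  c = frac (m′ * T G A) (suc n′)
  open Averaging (weightedSum G A) 𝟘 weightedSum-zero (trans total-weight (sym (ι*frac (m′ * T G A) (suc n′))))
  -- 1/m > 0, so it can be cancelled from e_δ ≤ bound
  instance
    1/m-positive : Positive (frac 1 (suc m′))
    1/m-positive = ℚP.normalize-pos 1 (suc m′)
  bound≡c/m : bound G A ≡ frac 1 (suc m′) *ℚ c
  bound≡c/m = frac-prod (m′ * T G A) (suc m′) (suc n′)
  optimal⇒rwedf : IsROptimal G A → ∃ λ ℓ → IsRWEDF G A ℓ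
  optimal⇒rwedf (e≤bound , _) = c , bounded⇒average (λ δ δ≢𝟘 →
    ℚP.*-cancelˡ-≤-pos (frac 1 (suc m′)) (subst (e G A δ ≤ℚ_) bound≡c/m (e≤bound δ δ≢𝟘)))
  rwedf⇒optimal : (∃ λ ℓ → IsRWEDF G A ℓ) → IsROptimal G A
  rwedf⇒optimal (ℓ , W≡ℓ) = (λ δ δ≢𝟘 → ℚP.≤-reflexive (e≡bound δ δ≢𝟘)) , (δ₀ , δ₀≢𝟘 , e≡bound δ₀ δ₀≢𝟘)
    where
    e≡bound : ∀ δ → δ ≢ 𝟘 → e G A δ ≡ bound G A
    e≡bound δ δ≢𝟘 = trans (cong (frac 1 (suc m′) *ℚ_) (trans (W≡ℓ δ δ≢𝟘) (constant⇒average ℓ W≡ℓ))) (sym bound≡c/m)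
    -- a nonzero element exists since n ≥ 2
    δ₀ : Fin (suc (suc n′))
    δ₀ = punchIn 𝟘 zero
    δ₀≢𝟘 : δ₀ ≢ 𝟘
    δ₀≢𝟘 = punchInᵢ≢i 𝟘 zero
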